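{- Let $D$ be a strongly connected digraph on $n$ vertices and let $v \in V(D)$ be a vertex satisfying $d(v) \geq n$. Then there exists a vertex $z \in V(D)\setminus\{v\}$ such that $D - z$ is strongly connected.
   Context: All digraphs are simple: no loops and no multiple edges (two oppositely directed edges between the same pair of vertices are allowed). A digraph is strongly connected if every vertex is reachable by a directed path from every other vertex. For a vertex $v$, $d(v) = |E^+(v)| + |E^-(v)|$, where $E^+(v)=\{u : (v,u)\in E(D)\}$ and $E^-(v)=\{u : (u,v)\in E(D)\}$. For a vertex $z$, $D-z$ denotes the digraph obtained from $D$ by deleting $z$ and all edges incident with it. -}

module Defs where

open import Data.Nat using (ℕ; suc; _+_)
open import Data.Fin using (Fin)
open import Data.Bool using (Bool; true; false; T)
open import Data.Unit using (⊤)
open import Data.List using (List; filter; length; allFin)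
open import Data.Bool.Properties using (T?)
open import Relation.Binary.PropositionalEquality using (_≡_; _≢_)

-- A simple digraph on vertex set Fin n: adjacency given as a Boolean matrix
-- (so at most one edge u→v for each ordered pair; both u→v and v→u allowed),
-- with no loops.
record Digraph (n : ℕ) : Set where
  field
    adj      : Fin n → Fin n → Bool
    loopless : ∀ v → adj v v ≡ false
open Digraph public

Edge : ∀ {n} → Digraph n → Fin n → Fin n → Set
Edge D u w = T (adj D u w)

outdeg : ∀ {n} → Digraph n → Fin n → ℕ
outdeg {n} D v = length (filter (λ u → T? (adj D v u)) (allFin n))

indeg : ∀ {n} → Digraph n → Fin n → ℕ
indeg {n} D v = length (filter (λ u → T? (adj D u v)) (allFin n))

deg : ∀ {n} → Digraph n → Fin n → ℕ
deg D v = outdeg D v + indeg D v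

data PathIn {n} (D : Digraph n) (P : Fin n → Set) : Fin n → Fin n → Set where
  here : ∀ {u} → P u → PathIn D P u u
  step : ∀ {u x w} → P u → Edge D u x → PathIn D P x w → PathIn D P u w

StronglyConnectedOn : ∀ {n} → Digraph n → (Fin n → Set) → Set
StronglyConnectedOn {n} D P = ∀ (u w : Fin n) → P u → P w → PathIn D P u w

StronglyConnected : ∀ {n} → Digraph n → Set
StronglyConnected D = StronglyConnectedOn D (λ _ → ⊤)

StronglyConnectedMinus : ∀ {n} → Digraph n → Fin n → Set
StronglyConnectedMinus D z = StronglyConnectedOn D (λ x → x ≢ z)

module Submission where

-- Say that u dominates w when every walk from v to w passes through u. Domination is a decidable
-- preorder, antisymmetric on the vertices reachable from v, and the dominators of a vertex form a
-- chain, so distinct out-neighbours of v dominate disjoint sets of vertices. Below each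
-- out-neighbour pick a minimal vertex z of the domination order: z dominates only itself, so v
-- still reaches every vertex of D − z. This yields d⁺(v) distinct such z ≠ v, and, in the reverse
-- digraph, d⁻(v) distinct z ≠ v from which every vertex of D − z reaches v. As d(v) ≥ n > n − 1,
-- some z lies in both families, and then D − z is strongly connected through v.

open import Defs
open import Data.Nat using (ℕ; suc; _+_; _≥_; _≤_; _<_)
open import Data.Nat.Induction using (<-wellFounded)
open import Data.Nat.Properties using (≤⇒≯)
open import Data.Fin using (Fin; zero; suc)
open import Data.Fin.Properties using (_≟_; any?; injective⇒≤)
open import Data.Fin.Subset using (Subset; ∣_∣; _⊂_; _-_; ∁; ⁅_⁆) renaming (_∈_ to _∈ₛ_)
open import Data.Fin.Subset.Properties
  renaming (_∈?_ to _∈ₛ?_)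
  using (x∈p⇒∣p-x∣<∣p∣; p─q⊆p; x∈p∧x≢y⇒x∈p-y; x∈∁p⇒x∉p; x∉p⇒x∈∁p; x∉⁅y⁆⇒x≢y; x≢y⇒x∉⁅y⁆; p⊂q⇒∣p∣<∣q∣)
open import Data.Vec using (tabulate)
open import Data.Vec.Properties using (lookup∘tabulate; lookup⇒[]=; []=⇒lookup)
open import Data.Product using (Σ; ∃-syntax; _×_; _,_; proj₁; proj₂)
open import Data.Sum using (_⊎_; inj₁; inj₂)
open import Data.Bool using (T)
open import Data.Bool.Properties using (T?)
open import Data.Unit using (tt)
open import Data.Empty using (⊥-elim)
open import Data.List using (List; []; _∷_; map; length; filter; allFin; lookup)
open import Data.List.Properties using (length-map; length-++)
open import Data.List.Relation.Unary.All as All using (All; []; _∷_)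
open import Data.List.Relation.Unary.All.Properties using (all-filter) renaming (map⁺ to All-map⁺; ++⁺ to All-++⁺)
open import Data.List.Relation.Unary.Any using (here; there) renaming (any? to anyˡ?)
open import Data.List.Relation.Unary.AllPairs using ([]; _∷_)
open import Data.List.Relation.Unary.Unique.Propositional using (Unique)
import Data.List.Relation.Unary.Unique.Propositional.Properties as Unique
open import Data.List.Relation.Binary.Disjoint.Propositional using (Disjoint)
open import Data.List.Membership.Propositional using (_∈_; find; lose)
open import Data.List.Membership.Propositional.Properties using (∈-lookup; ∈-filter⁻)
import Data.List.Membership.DecPropositional as DecMembership
open import Function using (_∘_; _on_)
open import Induction.WellFounded using (Acc; acc)
open import Relation.Binary.Construct.On using (wellFounded)
open import Relation.Binary.Definitions using (Decidable; Reflexive; Transitive)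
open import Relation.Binary.Core using (Rel)
open import Relation.Nullary using (¬_; Dec; yes; no; does; contradiction)
open import Relation.Nullary.Decidable using (map′; ¬?; _×-dec_; decidable-stable; dec-true)
open import Relation.Unary using (_∩_; _⊆_; U)
open import Relation.Binary.PropositionalEquality using (_≡_; _≢_; refl; sym; trans; subst; cong; cong₂)

module _ {n : ℕ} {D : Digraph n} where

  private variable
    P Q : Fin n → Set
    a b c s : Fin n

  edge⇒≢ : Edge D a b → a ≢ b
  edge⇒≢ {a} e refl = subst T (loopless D a) e

  source : PathIn D P a b → P a
  source (here p)     = p
  source (step p _ _) = p

  target : PathIn D P a b → P b
  target (here p)     = p
  target (step _ _ π) = target π

  mapPath : P ⊆ Q → PathIn D P a b → PathIn D Q a b
  mapPath f (here p)     = here (f p)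
  mapPath f (step p e π) = step (f p) e (mapPath f π)

  _++_ : PathIn D P a b → PathIn D P b c → PathIn D P a c
  here _     ++ σ = σ
  step p e π ++ σ = step p e (π ++ σ)

  snoc : PathIn D P a b → Edge D b c → P c → PathIn D P a c
  snoc (here p)     e pc = step p e (here pc)
  snoc (step p e π) f pc = step p e (snoc π f pc)

  data Departure (P : Fin n → Set) (s : Fin n) : Fin n → Set where
    stay   : Departure P s s
    depart : ∀ {x b} → Edge D s x → PathIn D (P ∩ (_≢ s)) x b → Departure P s b

  data Arrival (P : Fin n → Set) (s : Fin n) : Fin n → Set where
    arrived : P s → Arrival P s s
    arrive  : ∀ {a y} → PathIn D (P ∩ (_≢ s)) a y → Edge D y s → P s → Arrival P s a

  arrival⇒path : Arrival P s a → PathIn D P a s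
  arrival⇒path (arrived p)    = here p
  arrival⇒path (arrive ρ e p) = snoc (mapPath proj₁ ρ) e p

  lastVisit : ∀ s → PathIn D P a b → PathIn D (P ∩ (_≢ s)) a b ⊎ Departure P s b
  lastVisit {a = a} s (here p) with a ≟ s
  ... | yes refl = inj₂ stay
  ... | no a≢s   = inj₁ (here (p , a≢s))
  lastVisit {a = a} s (step p e π) with lastVisit s π | a ≟ s
  ... | inj₂ d  | _        = inj₂ d
  ... | inj₁ π′ | yes refl = inj₂ (depart e π′)
  ... | inj₁ π′ | no a≢s   = inj₁ (step (p , a≢s) e π′)

  firstVisit : ∀ s → PathIn D P a b → PathIn D (P ∩ (_≢ s)) a b ⊎ Arrival P s a
  firstVisit {a = a} s π with a ≟ s
  firstVisit s π            | yes refl = inj₂ (arrived (source π))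
  firstVisit s (here p)     | no a≢s   = inj₁ (here (p , a≢s))
  firstVisit s (step p e π) | no a≢s with firstVisit s π
  ... | inj₁ π′             = inj₁ (step (p , a≢s) e π′)
  ... | inj₂ (arrived q)    = inj₂ (arrive (here (p , a≢s)) e q)
  ... | inj₂ (arrive ρ f q) = inj₂ (arrive (step (p , a≢s) e ρ) f q)

reverse : ∀ {n} → Digraph n → Digraph n
reverse D = record { adj = λ a b → adj D b a ; loopless = loopless D }

reversePath : ∀ {n} {D : Digraph n} {P : Fin n → Set} {a b} →
              PathIn (reverse D) P a b → PathIn D P b a
reversePath (here p)     = here p
reversePath (step p e π) = snoc (reversePath π) e p

module _ {n : ℕ} (D : Digraph n) where

  pathWithin? : (p : Subset n) → ∀ a t → Dec (PathIn D (_∈ₛ p) a t)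
  pathWithin? p = go (wellFounded ∣_∣ <-wellFounded p)
    where
    go : ∀ {p} → Acc (_<_ on ∣_∣) p → ∀ a t → Dec (PathIn D (_∈ₛ p) a t)
    go {p} (acc rec) a t with a ∈ₛ? p | a ≟ t
    ... | no a∉p  | _        = no (a∉p ∘ source)
    ... | yes a∈p | yes refl = yes (here a∈p)
    ... | yes a∈p | no a≢t   =
      -- cutting the walk at its last visit to a lets a be removed from p
      map′ (λ (x , e , π) → step a∈p e (mapPath (p─q⊆p _ _) π)) exit
           (any? λ x → T? (adj D a x) ×-dec go (rec (x∈p⇒∣p-x∣<∣p∣ a∈p)) x t)
      where
      exit : PathIn D (_∈ₛ p) a t → ∃[ x ] Edge D a x × PathIn D (_∈ₛ p - a) x t
      exit π with lastVisit a π
      ... | inj₁ π′           = contradiction refl (proj₂ (source π′))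
      ... | inj₂ stay         = contradiction refl a≢t
      ... | inj₂ (depart e σ) = _ , e , mapPath (λ (x∈p , x≢a) → x∈p∧x≢y⇒x∈p-y x∈p x≢a) σ

  avoiding? : ∀ s a t → Dec (PathIn D (_≢ s) a t)
  avoiding? s a t = map′ (mapPath (x∉⁅y⁆⇒x≢y ∘ x∈∁p⇒x∉p)) (mapPath (x∉p⇒x∈∁p ∘ x≢y⇒x∉⁅y⁆))
                         (pathWithin? (∁ ⁅ s ⁆) a t)

module _ {n ℓ} {_≼_ : Rel (Fin n) ℓ} (_≼?_ : Decidable _≼_)
         (≼-refl : Reflexive _≼_) (≼-trans : Transitive _≼_) where

  private
    below : Fin n → Subset n
    below w = tabulate (λ x → does (x ≼? w))

    below⁺ : ∀ {x w} → x ≼ w → x ∈ₛ below w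
    below⁺ {x} {w} x≼w = lookup⇒[]= x _ (trans (lookup∘tabulate _ x) (dec-true (x ≼? w) x≼w))

    below⁻ : ∀ {x w} → x ∈ₛ below w → x ≼ w
    below⁻ {x} {w} x∈ with x ≼? w | trans (sym (lookup∘tabulate _ x)) ([]=⇒lookup x∈)
    ... | yes x≼w | _ = x≼w
    ... | no _    | ()

    below-⊂ : ∀ {x w} → x ≼ w → ¬ w ≼ x → below x ⊂ below w
    below-⊂ x≼w w⋠x = (λ y∈ → below⁺ (≼-trans (below⁻ y∈) x≼w)) , _ , below⁺ ≼-refl , w⋠x ∘ below⁻

  minimal-below : ∀ w → ∃[ m ] m ≼ w × (∀ x → x ≼ m → m ≼ x)
  minimal-below w = go (wellFounded (∣_∣ ∘ below) <-wellFounded w)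
    where
    go : ∀ {w} → Acc (_<_ on (∣_∣ ∘ below)) w → ∃[ m ] m ≼ w × (∀ x → x ≼ m → m ≼ x)
    go {w} (acc rec) with any? (λ x → x ≼? w ×-dec ¬? (w ≼? x))
    ... | yes (x , x≼w , w⋠x) with m , m≼x , minimal ← go (rec (p⊂q⇒∣p∣<∣q∣ (below-⊂ x≼w w⋠x)))
      = m , ≼-trans m≼x x≼w , minimal
    ... | no none = w , ≼-refl , λ x x≼w → decidable-stable (w ≼? x) (λ w⋠x → none (x , x≼w , w⋠x))

module _ {a} {A : Set a} where

  lookup-injective : ∀ {xs : List A} → Unique xs → ∀ {i j} → lookup xs i ≡ lookup xs j → i ≡ j
  lookup-injective (_  ∷ _) {zero}  {zero}  _  = refl
  lookup-injective (x∉ ∷ _) {zero}  {suc j} eq = contradiction eq (All.lookup x∉ (∈-lookup j))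
  lookup-injective (x∉ ∷ _) {suc i} {zero}  eq = contradiction (sym eq) (All.lookup x∉ (∈-lookup i))
  lookup-injective (_  ∷ u) {suc i} {suc j} eq = cong suc (lookup-injective u eq)

  map-unique : ∀ {b} {B : Set b} {f : A → B} {xs} →
               (∀ {x y} → x ∈ xs → y ∈ xs → f x ≡ f y → x ≡ y) → Unique xs → Unique (map f xs)
  map-unique inj []       = []
  map-unique inj (x∉ ∷ u) =
    All-map⁺ (All.tabulate λ y∈ fx≡fy → All.lookup x∉ y∈ (inj (here refl) (there y∈) fx≡fy))
    ∷ map-unique (λ x∈ y∈ → inj (there x∈) (there y∈)) u

module _ {n : ℕ} where

  unique⇒length≤ : ∀ {xs : List (Fin n)} → Unique xs → length xs ≤ n
  unique⇒length≤ u = injective⇒≤ (lookup-injective u)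

  disjoint-length< : ∀ {r} {xs ys : List (Fin n)} → All (_≢ r) xs → All (_≢ r) ys →
                     Unique xs → Unique ys → Disjoint xs ys → length xs + length ys < n
  disjoint-length< {r} {xs} xs≢r ys≢r xs! ys! disjoint =
    subst (λ k → suc k ≤ n) (length-++ xs)
          (unique⇒length≤ (All.map (_∘ sym) (All-++⁺ xs≢r ys≢r) ∷ Unique.++⁺ xs! ys! disjoint))

NonSeparating : ∀ {n} → Digraph n → Fin n → Fin n → Set
NonSeparating D r z = z ≢ r × (∀ x → x ≢ z → PathIn D (_≢ z) r x)

module Dominators {n : ℕ} (D : Digraph n) (r : Fin n) where

  _dominates_ : Fin n → Fin n → Set
  u dominates w = ¬ PathIn D (_≢ u) r w

  _dominates?_ : Decidable _dominates_
  u dominates? w = ¬? (avoiding? D u r w)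

  dominates-refl : Reflexive _dominates_
  dominates-refl π = target π refl

  dominates-trans : Transitive _dominates_
  dominates-trans {j = w} u≫w w≫x π with firstVisit w π
  ... | inj₁ π′ = w≫x (mapPath proj₂ π′)
  ... | inj₂ α  = u≫w (arrival⇒path α)

  dominated⇒≢root : ∀ {u w} → u ≢ r → u dominates w → w ≢ r
  dominated⇒≢root u≢r u≫w refl = u≫w (here (u≢r ∘ sym))

  dominates-antisym : ∀ {x w} → PathIn D U r w → x dominates w → w dominates x → x ≡ w
  dominates-antisym {x} {w} π x≫w w≫x with x ≟ w
  ... | yes x≡w = x≡w
  ... | no x≢w with firstVisit x π
  ...   | inj₁ π′             = ⊥-elim (x≫w (mapPath proj₂ π′))
  ...   | inj₂ (arrived _)    = ⊥-elim (w≫x (here x≢w))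
  ...   | inj₂ (arrive ρ e _) with firstVisit w ρ
  ...     | inj₁ ρ′             = ⊥-elim (w≫x (snoc (mapPath proj₂ ρ′) e x≢w))
  ...     | inj₂ (arrived _)    = ⊥-elim (x≫w (here (x≢w ∘ sym)))
  ...     | inj₂ (arrive τ f _) = ⊥-elim (x≫w (snoc (mapPath (proj₂ ∘ proj₁) τ) f (x≢w ∘ sym)))

  dominators-comparable : ∀ {u u′ w} → PathIn D U r w → u dominates w → u′ dominates w →
                          u dominates u′ ⊎ u′ dominates u
  dominators-comparable {u} {u′} π u≫w u′≫w with u ≟ u′
  ... | yes refl = inj₁ dominates-refl
  ... | no u≢u′ with lastVisit u π
  ...   | inj₁ π′           = ⊥-elim (u≫w (mapPath proj₂ π′))
  ...   | inj₂ stay         = inj₂ u′≫w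
  ...   | inj₂ (depart e σ) with lastVisit u′ σ
  ...     | inj₁ σ′           = inj₂ (λ ρ → u′≫w (ρ ++ step u≢u′ e (mapPath proj₂ σ′)))
  ...     | inj₂ stay         = inj₁ u≫w
  ...     | inj₂ (depart f τ) =
            inj₁ (λ ρ → u≫w (ρ ++ step (u≢u′ ∘ sym) f (mapPath (proj₂ ∘ proj₁) τ)))

  outNeighbours-dominate-disjointly : ∀ {u u′ w} → PathIn D U r w → Edge D r u → Edge D r u′ →
                                      u dominates w → u′ dominates w → u ≡ u′
  outNeighbours-dominate-disjointly {u} {u′} π e e′ u≫w u′≫w with u ≟ u′
  ... | yes u≡u′ = u≡u′
  ... | no u≢u′ with dominators-comparable π u≫w u′≫w
  ...   | inj₁ u≫u′ = ⊥-elim (u≫u′ (step (edge⇒≢ {D = D} e) e′ (here (u≢u′ ∘ sym))))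
  ...   | inj₂ u′≫u = ⊥-elim (u′≫u (step (edge⇒≢ {D = D} e′) e (here u≢u′)))

  module _ (reach : ∀ x → PathIn D U r x) where

    leafBelow : ∀ u → ∃[ z ] u dominates z × (∀ x → z dominates x → x dominates z)
    leafBelow = minimal-below (λ x w → w dominates? x) dominates-refl
                              (λ x≼y y≼z → dominates-trans y≼z x≼y)

    leaf : Fin n → Fin n
    leaf u = proj₁ (leafBelow u)

    dominates-leaf : ∀ u → u dominates leaf u
    dominates-leaf u = proj₁ (proj₂ (leafBelow u))

    leaf-nonSeparating : ∀ {u} → u ≢ r → NonSeparating D r (leaf u)
    leaf-nonSeparating {u} u≢r with z , u≫z , minimal ← leafBelow u =
      dominated⇒≢root u≢r u≫z ,
      λ x x≢z → decidable-stable (avoiding? D z r x)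
                  (λ z≫x → x≢z (dominates-antisym (reach z) (minimal x z≫x) z≫x))

    nonSeparatingVertices : ∃[ zs ] Unique zs × All (NonSeparating D r) zs × length zs ≡ outdeg D r
    nonSeparatingVertices =
      map leaf outNeighbours ,
      map-unique leaf-injective (Unique.filter⁺ isOut? (Unique.allFin⁺ n)) ,
      All-map⁺ (All.map (λ e → leaf-nonSeparating (edge⇒≢ {D = D} e ∘ sym))
                        (all-filter isOut? (allFin n))) ,
      length-map leaf outNeighbours
      where
      isOut? : (u : Fin n) → Dec (Edge D r u)
      isOut? u = T? (adj D r u)

      outNeighbours : List (Fin n)
      outNeighbours = filter isOut? (allFin n)

      leaf-injective : ∀ {u u′} → u ∈ outNeighbours → u′ ∈ outNeighbours → leaf u ≡ leaf u′ → u ≡ u′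
      leaf-injective {u} {u′} u∈ u′∈ eq =
        outNeighbours-dominate-disjointly (reach (leaf u))
          (proj₂ (∈-filter⁻ isOut? {xs = allFin n} u∈))
          (proj₂ (∈-filter⁻ isOut? {xs = allFin n} u′∈))
          (dominates-leaf u) (subst (u′ dominates_) (sym eq) (dominates-leaf u′))

nonSeparating⇒stronglyConnectedMinus : ∀ {n} {D : Digraph n} {r z} →
  NonSeparating D r z → NonSeparating (reverse D) r z → StronglyConnectedMinus D z
nonSeparating⇒stronglyConnectedMinus (_ , from-r) (_ , to-r) a b a≢z b≢z =
  reversePath (to-r a a≢z) ++ from-r b b≢z

lemma1 : (n : ℕ) (D : Digraph n) → StronglyConnected D →
         (v : Fin n) → deg D v ≥ n →
         Σ (Fin n) (λ z → z ≢ v × StronglyConnectedMinus D z)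
lemma1 n D sc v deg≥n
  with zs , zs! , zs-ok , |zs| ← Dominators.nonSeparatingVertices D v (λ x → sc v x tt tt)
     -- reverse (reverse D) is D up to η, so reversePath also turns walks of D into walks of reverse D
     | ws , ws! , ws-ok , |ws| ← Dominators.nonSeparatingVertices (reverse D) v
                                   (λ x → reversePath {D = reverse D} (sc x v tt tt))
  with anyˡ? (λ z → DecMembership._∈?_ _≟_ z ws) zs
... | yes common with z , z∈zs , z∈ws ← find common =
  z , proj₁ (All.lookup zs-ok z∈zs) ,
  nonSeparating⇒stronglyConnectedMinus (All.lookup zs-ok z∈zs) (All.lookup ws-ok z∈ws)
... | no no-common =
  contradiction (subst (_< n) (cong₂ _+_ |zs| |ws|)
                  (disjoint-length< (All.map proj₁ zs-ok) (All.map proj₁ ws-ok) zs! ws!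
                                    (λ (z∈zs , z∈ws) → no-common (lose z∈zs z∈ws))))
                (≤⇒≯ deg≥n)
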